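{- Let $\mathcal{C}$ be a pure $2$-dimensional $1$-decomposable simplicial complex, and let $\mathrm{full}(\mathcal{C})$ be the pure $2$-dimensional complex whose facets are all $3$-cliques (triangles) of the graph $\mathrm{skel}(\mathcal{C})$. Then the facets of $\mathrm{full}(\mathcal{C})$ not in $\mathcal{C}$ can be ordered $F_1,\dots,F_t$ so that $\mathcal{C}+\langle F_1,\dots,F_i\rangle$ is $1$-decomposable for every $1\le i\le t$.
   Context: Simplicial complexes, faces, facets, dimension and purity are as usual; $\langle F_1,\dots,F_k\rangle$ is the complex with facets $F_1,\dots,F_k$ and $\mathcal{C}+\langle G_1,\dots,G_k\rangle$ is the complex generated by the facets of $\mathcal{C}$ and $G_1,\dots,G_k$. For a nonempty face $F$: $\mathrm{lk}_F\mathcal{C}=\{G\in\mathcal{C}: G\cap F=\emptyset, G\cup F\in\mathcal{C}\}$, $\mathrm{del}_F\mathcal{C}=\{G\in\mathcal{C}: F\not\subseteq G\}$. A pure $d$-dimensional complex is $k$-decomposable if it is a simplex (one facet), or it has a face $F$ with $\dim F\le k$ such that $\mathrm{del}_F\mathcal{C}$ and $\mathrm{lk}_F\mathcal{C}$ are $k$-decomposable and $\mathrm{del}_F\mathcal{C}$ is pure of dimension $d$. $\mathrm{skel}(\mathcal{C})$ is the graph on the vertices of $\mathcal{C}$ whose edges are the $2$-element faces of $\mathcal{C}$. (One-dimensional complexes, i.e. graphs possibly with isolated vertices, are allowed to be non-pure.) -}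

module Defs where

open import Data.Nat using (ℕ; suc; _≤_; _∸_)
open import Data.Fin using (Fin)
open import Data.Fin.Subset using (Subset; _⊆_; _∩_; _∪_; ⊥; ∣_∣; Nonempty)
open import Data.Product using (Σ; ∃; _×_)
open import Data.Sum using (_⊎_)
open import Data.List using (List)
open import Data.List.Relation.Unary.Any using (Any)
open import Relation.Nullary using (¬_)
open import Relation.Binary.PropositionalEquality using (_≡_)

Cx : ℕ → Set₁
Cx n = Subset n → Set

module _ {n : ℕ} where

  IsComplex : Cx n → Set
  IsComplex K = ∀ F G → K F → G ⊆ F → K G

  IsFacet : Cx n → Subset n → Set
  IsFacet K F = K F × (∀ G → K G → F ⊆ G → F ≡ G)

  -- pure with all facets of cardinality s (i.e. dimension s - 1)
  PureSize : ℕ → Cx n → Set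
  PureSize s K = ∀ F → IsFacet K F → ∣ F ∣ ≡ s

  IsSimplex : Cx n → Set
  IsSimplex K = ∃ λ F → ∀ G → (K G → G ⊆ F) × (G ⊆ F → K G)

  lk : Subset n → Cx n → Cx n
  lk F K G = (G ∩ F ≡ ⊥) × K (G ∪ F)

  del : Subset n → Cx n → Cx n
  del F K G = K G × ¬ (F ⊆ G)

  data Decomp (k : ℕ) : ℕ → Cx n → Set₁ where
    simplex : ∀ {s K} → PureSize s K → IsSimplex K → Decomp k s K
    shed : ∀ {s K} (F : Subset n) → PureSize s K → K F → Nonempty F →
           ∣ F ∣ ≤ suc k →                      -- dim F ≤ k
           Decomp k s (del F K) →
           (∃ λ s' → Decomp k s' (lk F K)) →
           Decomp k s K

  KDecomposable : ℕ → Cx n → Set₁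
  KDecomposable k K = Σ ℕ λ s → Decomp k s K

  _+⟨_⟩ : Cx n → List (Subset n) → Cx n
  (K +⟨ Fs ⟩) G = K G ⊎ Any (λ F → G ⊆ F) Fs

  IsTriangleOfSkel : Cx n → Subset n → Set
  IsTriangleOfSkel K F = ∣ F ∣ ≡ 3 × (∀ E → E ⊆ F → ∣ E ∣ ≡ 2 → K E)

{-# OPTIONS --safe #-}
-- Let K be k-decomposable with facets of size s, 2 ≤ s ≤ k + 2, and T a new face of size s whose
-- boundary lies in K. Then K + ⟨T⟩ is k-decomposable, by induction along the shedding faces F of K.
-- A simplex cannot miss T, since it contains every vertex of T. If F ⊈ T, then F still sheds, and
-- its deletion is del F K + ⟨T⟩. If F ⊆ T, the deletion is unchanged (the proper faces of T are
-- already in K), and the link gains the single face T ∖ F, whose boundary it already contains. That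
-- face has size < s ≤ k + 2, so it can be shed first: its deletion is the old link and its link is
-- ⟨∅⟩. Every missing triangle of full(C) has its boundary in C, so they can be added in any order.
module Submission where

open import Defs
open import Data.Nat using (ℕ; zero; suc; _+_; _≤_; z≤n; s≤s)
import Data.Nat.Properties as ℕ
open import Data.Vec using ([]; _∷_; here; there)
open import Data.Vec.Properties using (∷-injectiveʳ)
open import Data.Fin using (Fin)
import Data.Fin.Properties as Fin
open import Data.Fin.Subset
  using (Subset; inside; outside; _⊆_; _⊃_; _∩_; _∪_; _─_; _-_; ⁅_⁆; ⊥; ∣_∣; Nonempty)
  renaming (_∈_ to _∈ₛ_; _∉_ to _∉ₛ_)
open import Data.Fin.Subset.Properties
  using ( _∈?_; _⊆?_; _⊂?_; ⊆-refl; ⊆-trans; ⊆-antisym; ∉⊥; Empty-unique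
        ; x∈p∩q⁺; x∈p∩q⁻; x∈p∪q⁺; x∈p∪q⁻; q⊆p∪q; x∈p∧x∉q⇒x∈p─q; p─q⊆p; x∈p∧x≢y⇒x∈p-y
        ; p∩q≢∅⇒∣p─q∣<∣p∣; p⊆q⇒∣p∣≤∣q∣; ∣⁅x⁆∣≡1; x∈⁅x⁆; x∈⁅y⁆⇒x≡y; ⊆-min; ∣⊥∣≡0; anySubset? )
open import Data.Fin.Subset.Induction using (⊃-wellFounded)
open import Induction.WellFounded using (Acc; acc)
open import Data.Product using (Σ; ∃; _×_; _,_; proj₁; proj₂; swap)
open import Data.Sum using (_⊎_; inj₁; inj₂; [_,_]′)
open import Data.List using (List; []; _∷_; take; length; map; _++_; filter)
open import Data.List.Membership.Propositional using (_∈_)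
open import Data.List.Membership.Propositional.Properties using (∈-filter⁺; ∈-++⁺ˡ; ∈-++⁺ʳ; ∈-map⁺; ∈-map⁻)
open import Data.List.Relation.Unary.Unique.Propositional using (Unique; []; _∷_)
import Data.List.Relation.Unary.Unique.Propositional.Properties as Unique
open import Data.List.Relation.Unary.All using (All; []; _∷_)
import Data.List.Relation.Unary.All as All
import Data.List.Relation.Unary.All.Properties as Allₚ
open import Data.List.Relation.Unary.Any using (here; there)
import Data.List.Relation.Unary.Any as Any
open import Relation.Nullary using (¬_; Dec; yes; no; ¬?; contradiction)
open import Relation.Nullary.Decidable using (_×-dec_; _→-dec_; map′; decidable-stable)
open import Relation.Unary using (Decidable; Satisfiable; _≐_)
open import Relation.Binary.PropositionalEquality using (_≡_; refl; sym; trans; cong; subst; module ≡-Reasoning)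
open import Function using (_∘_; id)

private variable
  n k s s′ : ℕ
  x : Fin n
  p q r F G T U : Subset n
  K L : Cx n

x∈p─q⇒x∉q : ∀ (p q : Subset n) → x ∈ₛ p ─ q → x ∉ₛ q
x∈p─q⇒x∉q (inside ∷ p) (outside ∷ q) here       ()
x∈p─q⇒x∉q (_ ∷ p)      (_ ∷ q)       (there x∈) (there x∈q) = x∈p─q⇒x∉q p q x∈ x∈q

p∩q≡⊥⇒x∉q : p ∩ q ≡ ⊥ → x ∈ₛ p → x ∉ₛ q
p∩q≡⊥⇒x∉q p∩q≡⊥ x∈p x∈q = ∉⊥ (subst (_ ∈ₛ_) p∩q≡⊥ (x∈p∩q⁺ (x∈p , x∈q)))

x∉q⇒p∩q≡⊥ : (∀ {x} → x ∈ₛ p → x ∉ₛ q) → p ∩ q ≡ ⊥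
x∉q⇒p∩q≡⊥ {p = p} {q = q} x∉q = Empty-unique λ (x , x∈p∩q) →
  let (x∈p , x∈q) = x∈p∩q⁻ p q x∈p∩q in x∉q x∈p x∈q

p─q∩q≡⊥ : ∀ (p q : Subset n) → (p ─ q) ∩ q ≡ ⊥
p─q∩q≡⊥ p q = x∉q⇒p∩q≡⊥ (x∈p─q⇒x∉q p q)

p─q∪q≡p : q ⊆ p → (p ─ q) ∪ q ≡ p
p─q∪q≡p {q = q} {p = p} q⊆p = ⊆-antisym [p─q]∪q⊆p p⊆[p─q]∪q
  where
  [p─q]∪q⊆p : (p ─ q) ∪ q ⊆ p
  [p─q]∪q⊆p x∈ = [ p─q⊆p p q , q⊆p ]′ (x∈p∪q⁻ (p ─ q) q x∈)
  p⊆[p─q]∪q : p ⊆ (p ─ q) ∪ q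
  p⊆[p─q]∪q {x} x∈p with x ∈? q
  ... | yes x∈q = x∈p∪q⁺ (inj₂ x∈q)
  ... | no  x∉q = x∈p∪q⁺ (inj₁ (x∈p∧x∉q⇒x∈p─q x∈p x∉q))

p⊈q⇒∃x∈p∖q : ¬ p ⊆ q → ∃ λ x → x ∈ₛ p × x ∉ₛ q
p⊈q⇒∃x∈p∖q {p = p} {q = q} p⊈q with Fin.any? (λ x → (x ∈? p) ×-dec ¬? (x ∈? q))
... | yes x∈p∖q = x∈p∖q
... | no ∄x∈p∖q = contradiction (λ {x} x∈p → decidable-stable (x ∈? q) (λ x∉q → ∄x∈p∖q (x , x∈p , x∉q))) p⊈q

∣p∪q∣≡∣p∣+∣q∣ : ∀ (p q : Subset n) → p ∩ q ≡ ⊥ → ∣ p ∪ q ∣ ≡ ∣ p ∣ + ∣ q ∣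
∣p∪q∣≡∣p∣+∣q∣ []            []            _  = refl
∣p∪q∣≡∣p∣+∣q∣ (inside  ∷ p) (inside  ∷ q) ()
∣p∪q∣≡∣p∣+∣q∣ (inside  ∷ p) (outside ∷ q) eq = cong suc (∣p∪q∣≡∣p∣+∣q∣ p q (∷-injectiveʳ eq))
∣p∪q∣≡∣p∣+∣q∣ (outside ∷ p) (inside  ∷ q) eq =
  trans (cong suc (∣p∪q∣≡∣p∣+∣q∣ p q (∷-injectiveʳ eq))) (sym (ℕ.+-suc ∣ p ∣ ∣ q ∣))
∣p∪q∣≡∣p∣+∣q∣ (outside ∷ p) (outside ∷ q) eq = ∣p∪q∣≡∣p∣+∣q∣ p q (∷-injectiveʳ eq)

∣p─q∣+∣q∣≡∣p∣ : q ⊆ p → ∣ p ─ q ∣ + ∣ q ∣ ≡ ∣ p ∣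
∣p─q∣+∣q∣≡∣p∣ {q = q} {p = p} q⊆p = begin
  ∣ p ─ q ∣ + ∣ q ∣  ≡⟨ ∣p∪q∣≡∣p∣+∣q∣ (p ─ q) q (p─q∩q≡⊥ p q) ⟨
  ∣ (p ─ q) ∪ q ∣    ≡⟨ cong ∣_∣ (p─q∪q≡p q⊆p) ⟩
  ∣ p ∣              ∎
  where open ≡-Reasoning

x∈p⇒⁅x⁆⊆p : x ∈ₛ p → ⁅ x ⁆ ⊆ p
x∈p⇒⁅x⁆⊆p {x = x} {p = p} x∈p y∈⁅x⁆ = subst (_∈ₛ p) (sym (x∈⁅y⁆⇒x≡y x y∈⁅x⁆)) x∈p

p⊆q─r⇒p∩r≡⊥ : p ⊆ q ─ r → p ∩ r ≡ ⊥
p⊆q─r⇒p∩r≡⊥ {q = q} {r = r} p⊆q─r = x∉q⇒p∩q≡⊥ (λ x∈p → x∈p─q⇒x∉q q r (p⊆q─r x∈p))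

p⊆q─r⇒p∪r⊆q : r ⊆ q → p ⊆ q ─ r → p ∪ r ⊆ q
p⊆q─r⇒p∪r⊆q {r = r} {q = q} {p = p} r⊆q p⊆q─r x∈ = [ p─q⊆p q r ∘ p⊆q─r , r⊆q ]′ (x∈p∪q⁻ p r x∈)

p∪r⊆q⇒p⊆q─r : p ∩ r ≡ ⊥ → p ∪ r ⊆ q → p ⊆ q ─ r
p∪r⊆q⇒p⊆q─r p∩r≡⊥ p∪r⊆q x∈p = x∈p∧x∉q⇒x∈p─q (p∪r⊆q (x∈p∪q⁺ (inj₁ x∈p))) (p∩q≡⊥⇒x∉q p∩r≡⊥ x∈p)

p⊆q∪r⇒p─r⊆q : p ⊆ q ∪ r → p ─ r ⊆ q
p⊆q∪r⇒p─r⊆q {p = p} {q = q} {r = r} p⊆q∪r x∈p─r =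
  [ id , (λ x∈r → contradiction x∈r (x∈p─q⇒x∉q p r x∈p─r)) ]′ (x∈p∪q⁻ q r (p⊆q∪r (p─q⊆p p r x∈p─r)))

_⊕_ : Cx n → Subset n → Cx n
(K ⊕ T) G = K G ⊎ G ⊆ T

⟨∅⟩ : Cx n
⟨∅⟩ G = G ⊆ ⊥

BoundaryIn : Cx n → Subset n → Set
BoundaryIn K T = ∀ G → G ⊆ T → ¬ T ⊆ G → K G

del-isComplex : IsComplex K → IsComplex (del F K)
del-isComplex cK G G′ (KG , F⊈G) G′⊆G = cK G G′ KG G′⊆G , λ F⊆G′ → F⊈G (⊆-trans F⊆G′ G′⊆G)

lk-isComplex : IsComplex K → IsComplex (lk F K)
lk-isComplex {F = F} cK G G′ (G∩F≡⊥ , KG∪F) G′⊆G =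
  x∉q⇒p∩q≡⊥ (p∩q≡⊥⇒x∉q G∩F≡⊥ ∘ G′⊆G) , cK _ _ KG∪F G′∪F⊆G∪F
  where
  G′∪F⊆G∪F : G′ ∪ F ⊆ G ∪ F
  G′∪F⊆G∪F x∈ = x∈p∪q⁺ ([ inj₁ ∘ G′⊆G , inj₂ ]′ (x∈p∪q⁻ G′ F x∈))

+⟨⟩-isComplex : IsComplex K → ∀ Fs → IsComplex (K +⟨ Fs ⟩)
+⟨⟩-isComplex cK Fs F G (inj₁ KF)     G⊆F = inj₁ (cK F G KF G⊆F)
+⟨⟩-isComplex cK Fs F G (inj₂ F⊆some)   G⊆F = inj₂ (Any.map (⊆-trans G⊆F) F⊆some)

PureSize-resp-≐ : K ≐ L → PureSize s K → PureSize s L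
PureSize-resp-≐ (K⊆L , L⊆K) pK F (LF , F-max) = pK F (L⊆K LF , λ G KG → F-max G (K⊆L KG))

IsSimplex-resp-≐ : K ≐ L → IsSimplex K → IsSimplex L
IsSimplex-resp-≐ (K⊆L , L⊆K) (F , K≡⟨F⟩) = F , λ G → proj₁ (K≡⟨F⟩ G) ∘ L⊆K , K⊆L ∘ proj₂ (K≡⟨F⟩ G)

del-resp-≐ : K ≐ L → del F K ≐ del F L
del-resp-≐ (K⊆L , L⊆K) = (λ (KG , F⊈G) → K⊆L KG , F⊈G) , (λ (LG , F⊈G) → L⊆K LG , F⊈G)

lk-resp-≐ : K ≐ L → lk F K ≐ lk F L
lk-resp-≐ (K⊆L , L⊆K) = (λ (disj , KG∪F) → disj , K⊆L KG∪F) , (λ (disj , LG∪F) → disj , L⊆K LG∪F)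

Decomp-resp-≐ : K ≐ L → Decomp k s K → Decomp k s L
Decomp-resp-≐ K≐L (simplex pK sK) = simplex (PureSize-resp-≐ K≐L pK) (IsSimplex-resp-≐ K≐L sK)
Decomp-resp-≐ K≐L (shed F pK KF F≢∅ ∣F∣≤ dd (s′ , dl)) =
  shed F (PureSize-resp-≐ K≐L pK) (proj₁ K≐L KF) F≢∅ ∣F∣≤
       (Decomp-resp-≐ (del-resp-≐ K≐L) dd) (s′ , Decomp-resp-≐ (lk-resp-≐ K≐L) dl)

Decomp⇒PureSize : Decomp k s K → PureSize s K
Decomp⇒PureSize (simplex pK _)         = pK
Decomp⇒PureSize (shed _ pK _ _ _ _ _) = pK

Decomp⇒Satisfiable : Decomp k s K → Satisfiable K
Decomp⇒Satisfiable (simplex _ (F , K≡⟨F⟩)) = F , proj₂ (K≡⟨F⟩ F) ⊆-refl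
Decomp⇒Satisfiable (shed F _ KF _ _ _ _)   = F , KF

lk-─ : F ⊆ G → K G → lk F K (G ─ F)
lk-─ {F = F} {G = G} {K = K} F⊆G KG = p─q∩q≡⊥ G F , subst K (sym (p─q∪q≡p F⊆G)) KG

lk-─⁻ : F ⊆ G → lk F K (G ─ F) → K G
lk-─⁻ {K = K} F⊆G (_ , KG) = subst K (p─q∪q≡p F⊆G) KG

Decomp⇒Decidable : Decomp k s K → Decidable K
Decomp⇒Decidable (simplex _ (F , K≡⟨F⟩)) G = map′ (proj₂ (K≡⟨F⟩ G)) (proj₁ (K≡⟨F⟩ G)) (G ⊆? F)
Decomp⇒Decidable {K = K} (shed F _ _ _ _ dd (_ , dl)) G with F ⊆? G
... | yes F⊆G = map′ (lk-─⁻ {K = K} F⊆G) (lk-─ {K = K} F⊆G) (Decomp⇒Decidable dl (G ─ F))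
... | no  F⊈G = map′ proj₁ (_, F⊈G) (Decomp⇒Decidable dd G)

Decidable⇒facet : Decidable K → K G → ∃ (IsFacet K)
Decidable⇒facet {K = K} {G = G} K? KG = go G (⊃-wellFounded G) KG
  where
  go : ∀ G → Acc _⊃_ G → K G → ∃ (IsFacet K)
  go G (acc rec) KG with anySubset? (λ H → K? H ×-dec G ⊂? H)
  ... | yes (H , KH , G⊂H) = go H (rec G⊂H) KH
  ... | no  ∄H⊃G           = G , KG , G-max
    where
    G-max : ∀ H → K H → G ⊆ H → G ≡ H
    G-max H KH G⊆H with H ⊆? G
    ... | yes H⊆G = ⊆-antisym G⊆H H⊆G
    ... | no  H⊈G = contradiction (H , KH , (λ {_} → G⊆H) , p⊈q⇒∃x∈p∖q H⊈G) ∄H⊃G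

Decomp⇒facet : Decomp k s K → ∃ (IsFacet K)
Decomp⇒facet d = Decidable⇒facet (Decomp⇒Decidable d) (proj₂ (Decomp⇒Satisfiable d))

Decomp-pureSize-≡ : Decomp k s K → PureSize s′ K → s ≡ s′
Decomp-pureSize-≡ d pK = let (H , H-facet) = Decomp⇒facet d in
  trans (sym (Decomp⇒PureSize d H H-facet)) (pK H H-facet)

lk-facet⇒facet : IsFacet (lk F K) G → IsFacet K (G ∪ F)
lk-facet⇒facet {F = F} {K = K} {G = G} ((G∩F≡⊥ , KG∪F) , G-max) = KG∪F , G∪F-max
  where
  G∪F-max : ∀ H → K H → G ∪ F ⊆ H → G ∪ F ≡ H
  G∪F-max H KH G∪F⊆H = begin
    G ∪ F        ≡⟨ cong (_∪ F) (G-max (H ─ F) (lk-─ {K = K} F⊆H KH) (p∪r⊆q⇒p⊆q─r G∩F≡⊥ G∪F⊆H)) ⟩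
    (H ─ F) ∪ F  ≡⟨ p─q∪q≡p F⊆H ⟩
    H            ∎
    where
    open ≡-Reasoning
    F⊆H : F ⊆ H
    F⊆H x∈F = G∪F⊆H (x∈p∪q⁺ (inj₂ x∈F))

lk-Decomp-size : PureSize s K → Decomp k s′ (lk F K) → s′ + ∣ F ∣ ≡ s
lk-Decomp-size {s = s} {s′ = s′} {F = F} pK dl with Decomp⇒facet dl
... | G , G-facet = begin
  s′ + ∣ F ∣     ≡⟨ cong (_+ ∣ F ∣) (Decomp⇒PureSize dl G G-facet) ⟨
  ∣ G ∣ + ∣ F ∣  ≡⟨ ∣p∪q∣≡∣p∣+∣q∣ G F (proj₁ (proj₁ G-facet)) ⟨
  ∣ G ∪ F ∣      ≡⟨ pK (G ∪ F) (lk-facet⇒facet G-facet) ⟩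
  s              ∎
  where open ≡-Reasoning

⊕-pureSize : PureSize s K → ∣ T ∣ ≡ s → PureSize s (K ⊕ T)
⊕-pureSize pK ∣T∣≡s H (inj₁ KH  , H-max) = pK H (KH , λ G KG → H-max G (inj₁ KG))
⊕-pureSize {T = T} pK ∣T∣≡s H (inj₂ H⊆T , H-max) = trans (cong ∣_∣ (H-max T (inj₂ ⊆-refl) H⊆T)) ∣T∣≡s

⊕-absorb : IsComplex K → K T → K ⊕ T ≐ K
⊕-absorb cK KT = (λ { (inj₁ KG) → KG ; (inj₂ G⊆T) → cK _ _ KT G⊆T }) , inj₁

del-⊕-⊈ : ¬ F ⊆ T → del F (K ⊕ T) ≐ del F K ⊕ T
del-⊕-⊈ F⊈T =
    (λ { (inj₁ KG , F⊈G) → inj₁ (KG , F⊈G) ; (inj₂ G⊆T , _) → inj₂ G⊆T })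
  , (λ { (inj₁ (KG , F⊈G)) → inj₁ KG , F⊈G
       ; (inj₂ G⊆T) → inj₂ G⊆T , λ F⊆G → F⊈T (⊆-trans F⊆G G⊆T) })

lk-⊕-⊈ : ¬ F ⊆ T → lk F (K ⊕ T) ≐ lk F K
lk-⊕-⊈ F⊈T =
    (λ { (G∩F≡⊥ , inj₁ KG∪F) → G∩F≡⊥ , KG∪F
       ; (_ , inj₂ G∪F⊆T) → contradiction (λ {_} x∈F → G∪F⊆T (x∈p∪q⁺ (inj₂ x∈F))) F⊈T })
  , (λ (G∩F≡⊥ , KG∪F) → G∩F≡⊥ , inj₁ KG∪F)

del-⊕-⊆ : BoundaryIn K T → F ⊆ T → del F (K ⊕ T) ≐ del F K
del-⊕-⊆ ∂T F⊆T =
    (λ { (inj₁ KG , F⊈G) → KG , F⊈G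
       ; (inj₂ G⊆T , F⊈G) → ∂T _ G⊆T (λ T⊆G → F⊈G (⊆-trans F⊆T T⊆G)) , F⊈G })
  , (λ (KG , F⊈G) → inj₁ KG , F⊈G)

lk-⊕-⊆ : F ⊆ T → lk F (K ⊕ T) ≐ lk F K ⊕ (T ─ F)
lk-⊕-⊆ F⊆T =
    (λ { (G∩F≡⊥ , inj₁ KG∪F) → inj₁ (G∩F≡⊥ , KG∪F)
       ; (G∩F≡⊥ , inj₂ G∪F⊆T) → inj₂ (p∪r⊆q⇒p⊆q─r G∩F≡⊥ G∪F⊆T) })
  , (λ { (inj₁ (G∩F≡⊥ , KG∪F)) → G∩F≡⊥ , inj₁ KG∪F
       ; (inj₂ G⊆T─F) → p⊆q─r⇒p∩r≡⊥ G⊆T─F , inj₂ (p⊆q─r⇒p∪r⊆q F⊆T G⊆T─F) })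

BoundaryIn-del : ¬ F ⊆ T → BoundaryIn K T → BoundaryIn (del F K) T
BoundaryIn-del F⊈T ∂T G G⊆T T⊈G = ∂T G G⊆T T⊈G , λ F⊆G → F⊈T (⊆-trans F⊆G G⊆T)

BoundaryIn-lk : F ⊆ T → BoundaryIn K T → BoundaryIn (lk F K) (T ─ F)
BoundaryIn-lk F⊆T ∂T G G⊆T─F T─F⊈G =
  p⊆q─r⇒p∩r≡⊥ G⊆T─F , ∂T _ (p⊆q─r⇒p∪r⊆q F⊆T G⊆T─F) (T─F⊈G ∘ p⊆q∪r⇒p─r⊆q)

IsSimplex-BoundaryIn⇒face : IsSimplex K → 2 ≤ ∣ T ∣ → BoundaryIn K T → K T
IsSimplex-BoundaryIn⇒face {T = T} (S , K≡⟨S⟩) 2≤∣T∣ ∂T = proj₂ (K≡⟨S⟩ T) T⊆S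
  where
  T⊆S : T ⊆ S
  T⊆S {x} x∈T = proj₁ (K≡⟨S⟩ ⁅ x ⁆) (∂T ⁅ x ⁆ (x∈p⇒⁅x⁆⊆p x∈T) T⊈⁅x⁆) (x∈⁅x⁆ x)
    where
    T⊈⁅x⁆ : ¬ T ⊆ ⁅ x ⁆
    T⊈⁅x⁆ T⊆⁅x⁆ = ℕ.<⇒≱ 2≤∣T∣ (subst (∣ T ∣ ≤_) (∣⁅x⁆∣≡1 x) (p⊆q⇒∣p∣≤∣q∣ T⊆⁅x⁆))

⟨∅⟩-Decomp : Decomp k 0 (⟨∅⟩ {n})
⟨∅⟩-Decomp {n = n} = simplex ⟨∅⟩-pure (⊥ , λ G → id , id)
  where
  ⟨∅⟩-pure : PureSize 0 (⟨∅⟩ {n})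
  ⟨∅⟩-pure H (H⊆⊥ , _) = trans (cong ∣_∣ (⊆-antisym H⊆⊥ (⊆-min H))) (∣⊥∣≡0 n)

¬face⇒Nonempty : IsComplex L → Satisfiable L → ¬ L U → Nonempty U
¬face⇒Nonempty cL (G , LG) ¬LU =
  let (x , x∈U , _) = p⊈q⇒∃x∈p∖q (λ U⊆G → ¬LU (cL G _ LG U⊆G)) in x , x∈U

del-⊕-self : IsComplex L → BoundaryIn L U → ¬ L U → del U (L ⊕ U) ≐ L
del-⊕-self cL ∂U ¬LU =
    (λ { (inj₁ LG , _) → LG ; (inj₂ G⊆U , U⊈G) → ∂U _ G⊆U U⊈G })
  , (λ LG → inj₁ LG , λ U⊆G → ¬LU (cL _ _ LG U⊆G))

lk-⊕-self : IsComplex L → ¬ L U → lk U (L ⊕ U) ≐ ⟨∅⟩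
lk-⊕-self {U = U} cL ¬LU =
    (λ { (_ , inj₁ LG∪U) → contradiction (cL _ U LG∪U (q⊆p∪q _ U)) ¬LU
       ; (G∩U≡⊥ , inj₂ G∪U⊆U) x∈G → contradiction (G∪U⊆U (x∈p∪q⁺ (inj₁ x∈G))) (p∩q≡⊥⇒x∉q G∩U≡⊥ x∈G) })
  , (λ G⊆⊥ → x∉q⇒p∩q≡⊥ (λ x∈G → contradiction (G⊆⊥ x∈G) ∉⊥)
           , inj₂ (λ x∈G∪U → [ (λ x∈G → contradiction (G⊆⊥ x∈G) ∉⊥) , id ]′ (x∈p∪q⁻ _ U x∈G∪U)))

Decomp-⊕-shed : IsComplex L → Decomp k s L → ∣ U ∣ ≡ s → ∣ U ∣ ≤ suc k → BoundaryIn L U → ¬ L U →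
                Decomp k s (L ⊕ U)
Decomp-⊕-shed cL d ∣U∣≡s ∣U∣≤1+k ∂U ¬LU =
  shed _ (⊕-pureSize (Decomp⇒PureSize d) ∣U∣≡s) (inj₂ ⊆-refl)
       (¬face⇒Nonempty cL (Decomp⇒Satisfiable d) ¬LU) ∣U∣≤1+k
       (Decomp-resp-≐ (swap (del-⊕-self cL ∂U ¬LU)) d)
       (0 , Decomp-resp-≐ (swap (lk-⊕-self cL ¬LU)) ⟨∅⟩-Decomp)

lk-⊕-Decomp : IsComplex K → PureSize s K → Decomp k s′ (lk F K) → Nonempty F → F ⊆ T →
              ∣ T ∣ ≡ s → s ≤ 2 + k → BoundaryIn K T → ¬ K T → Decomp k s′ (lk F (K ⊕ T))
lk-⊕-Decomp {K = K} {s = s} {k = k} {s′ = s′} {F = F} {T = T}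
            cK pK dl (x , x∈F) F⊆T ∣T∣≡s s≤2+k ∂T ¬KT =
  Decomp-resp-≐ (swap (lk-⊕-⊆ {K = K} F⊆T))
    (Decomp-⊕-shed (lk-isComplex {K = K} cK) dl ∣T─F∣≡s′ ∣T─F∣≤1+k
                   (BoundaryIn-lk F⊆T ∂T) (¬KT ∘ lk-─⁻ {K = K} F⊆T))
  where
  open ≡-Reasoning
  ∣T─F∣≡s′ : ∣ T ─ F ∣ ≡ s′
  ∣T─F∣≡s′ = ℕ.+-cancelʳ-≡ ∣ F ∣ _ _ (begin
    ∣ T ─ F ∣ + ∣ F ∣  ≡⟨ ∣p─q∣+∣q∣≡∣p∣ F⊆T ⟩
    ∣ T ∣              ≡⟨ ∣T∣≡s ⟩
    s                  ≡⟨ lk-Decomp-size pK dl ⟨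
    s′ + ∣ F ∣         ∎)
  ∣T─F∣≤1+k : ∣ T ─ F ∣ ≤ suc k
  ∣T─F∣≤1+k = ℕ.≤-pred (ℕ.≤-trans (p∩q≢∅⇒∣p─q∣<∣p∣ T F (x , x∈p∩q⁺ (F⊆T x∈F , x∈F)))
                                 (subst (_≤ 2 + k) (sym ∣T∣≡s) s≤2+k))

Decomp-⊕-new : IsComplex K → Decomp k s K → ∣ T ∣ ≡ s → 2 ≤ s → s ≤ 2 + k → BoundaryIn K T → ¬ K T →
               Decomp k s (K ⊕ T)
Decomp-⊕-new cK (simplex _ K-simplex) ∣T∣≡s 2≤s _ ∂T ¬KT =
  contradiction (IsSimplex-BoundaryIn⇒face K-simplex (subst (2 ≤_) (sym ∣T∣≡s) 2≤s) ∂T) ¬KT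
Decomp-⊕-new {K = K} {T = T} cK (shed F pK KF F≢∅ ∣F∣≤1+k dd (s′ , dl)) ∣T∣≡s 2≤s s≤2+k ∂T ¬KT
  with F ⊆? T
... | no F⊈T = shed F (⊕-pureSize pK ∣T∣≡s) (inj₁ KF) F≢∅ ∣F∣≤1+k
  (Decomp-resp-≐ (swap (del-⊕-⊈ F⊈T))
    (Decomp-⊕-new (del-isComplex cK) dd ∣T∣≡s 2≤s s≤2+k (BoundaryIn-del F⊈T ∂T) (¬KT ∘ proj₁)))
  (s′ , Decomp-resp-≐ (swap (lk-⊕-⊈ {K = K} F⊈T)) dl)
... | yes F⊆T = shed F (⊕-pureSize pK ∣T∣≡s) (inj₁ KF) F≢∅ ∣F∣≤1+k
  (Decomp-resp-≐ (swap (del-⊕-⊆ ∂T F⊆T)) dd)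
  (s′ , lk-⊕-Decomp cK pK dl F≢∅ F⊆T ∣T∣≡s s≤2+k ∂T ¬KT)

Decomp-⊕ : IsComplex K → Decomp k s K → ∣ T ∣ ≡ s → 2 ≤ s → s ≤ 2 + k → BoundaryIn K T → Decomp k s (K ⊕ T)
Decomp-⊕ {T = T} cK d ∣T∣≡s 2≤s s≤2+k ∂T with Decomp⇒Decidable d T
... | yes KT  = Decomp-resp-≐ (swap (⊕-absorb cK KT)) d
... | no  ¬KT = Decomp-⊕-new cK d ∣T∣≡s 2≤s s≤2+k ∂T ¬KT

+⟨[]⟩≐ : K +⟨ [] ⟩ ≐ K
+⟨[]⟩≐ = (λ { (inj₁ KG) → KG ; (inj₂ ()) }) , inj₁

+⟨∷⟩≐⊕ : ∀ {Ts} → K +⟨ T ∷ Ts ⟩ ≐ (K +⟨ Ts ⟩) ⊕ T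
+⟨∷⟩≐⊕ =
    (λ { (inj₁ KG) → inj₁ (inj₁ KG) ; (inj₂ (here G⊆T)) → inj₂ G⊆T ; (inj₂ (there G⊆some)) → inj₁ (inj₂ G⊆some) })
  , (λ { (inj₁ (inj₁ KG)) → inj₁ KG ; (inj₁ (inj₂ G⊆some)) → inj₂ (there G⊆some) ; (inj₂ G⊆T) → inj₂ (here G⊆T) })

Decomp-+⟨⟩ : IsComplex K → Decomp k s K → 2 ≤ s → s ≤ 2 + k →
             ∀ Ts → All (λ T → ∣ T ∣ ≡ s × BoundaryIn K T) Ts → Decomp k s (K +⟨ Ts ⟩)
Decomp-+⟨⟩ cK d 2≤s s≤2+k [] [] = Decomp-resp-≐ (swap +⟨[]⟩≐) d
Decomp-+⟨⟩ cK d 2≤s s≤2+k (T ∷ Ts) ((∣T∣≡s , ∂T) ∷ Ts-ok) =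
  Decomp-resp-≐ (swap +⟨∷⟩≐⊕)
    (Decomp-⊕ (+⟨⟩-isComplex cK Ts) (Decomp-+⟨⟩ cK d 2≤s s≤2+k Ts Ts-ok) ∣T∣≡s 2≤s s≤2+k
              (λ G G⊆T T⊈G → inj₁ (∂T G G⊆T T⊈G)))

triangle⇒BoundaryIn : IsComplex K → IsTriangleOfSkel K T → BoundaryIn K T
triangle⇒BoundaryIn {T = T} cK (∣T∣≡3 , edges) G G⊆T T⊈G =
  let (y , y∈T , y∉G) = p⊈q⇒∃x∈p∖q T⊈G in
  cK (T - y) G (edges (T - y) (p─q⊆p T ⁅ y ⁆) (∣T-y∣≡2 y∈T))
     (λ x∈G → x∈p∧x≢y⇒x∈p-y (G⊆T x∈G) λ { refl → y∉G x∈G })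
  where
  open ≡-Reasoning
  ∣T-y∣≡2 : ∀ {y} → y ∈ₛ T → ∣ T - y ∣ ≡ 2
  ∣T-y∣≡2 {y} y∈T = ℕ.+-cancelʳ-≡ 1 _ _ (begin
    ∣ T - y ∣ + 1          ≡⟨ cong (∣ T - y ∣ +_) (∣⁅x⁆∣≡1 y) ⟨
    ∣ T - y ∣ + ∣ ⁅ y ⁆ ∣  ≡⟨ ∣p─q∣+∣q∣≡∣p∣ (x∈p⇒⁅x⁆⊆p y∈T) ⟩
    ∣ T ∣                  ≡⟨ ∣T∣≡3 ⟩
    3                      ∎)

allSubsets : ∀ n → List (Subset n)
allSubsets zero    = [] ∷ []
allSubsets (suc n) = map (inside ∷_) (allSubsets n) ++ map (outside ∷_) (allSubsets n)

∈-allSubsets : ∀ (p : Subset n) → p ∈ allSubsets n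
∈-allSubsets []                    = here refl
∈-allSubsets {suc n} (inside  ∷ p) = ∈-++⁺ˡ (∈-map⁺ (inside ∷_) (∈-allSubsets p))
∈-allSubsets {suc n} (outside ∷ p) =
  ∈-++⁺ʳ (map (inside ∷_) (allSubsets n)) (∈-map⁺ (outside ∷_) (∈-allSubsets p))

allSubsets-unique : ∀ n → Unique (allSubsets n)
allSubsets-unique zero    = [] ∷ []
allSubsets-unique (suc n) =
  Unique.++⁺ (Unique.map⁺ ∷-injectiveʳ (allSubsets-unique n))
             (Unique.map⁺ ∷-injectiveʳ (allSubsets-unique n)) disjoint
  where
  disjoint : ∀ {p} → ¬ (p ∈ map (inside ∷_) (allSubsets n) × p ∈ map (outside ∷_) (allSubsets n))
  disjoint (p∈ins , p∈outs) with ∈-map⁻ (inside ∷_) p∈ins | ∈-map⁻ (outside ∷_) p∈outs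
  ... | _ , _ , refl | _ , _ , ()

allSubset? : {P : Subset n → Set} → Decidable P → Dec (∀ p → P p)
allSubset? P? with anySubset? (¬? ∘ P?)
... | yes (p , ¬Pp) = no λ ∀P → ¬Pp (∀P p)
... | no  ∄¬P       = yes λ p → decidable-stable (P? p) λ ¬Pp → ∄¬P (p , ¬Pp)

isTriangleOfSkel? : Decidable K → Decidable (IsTriangleOfSkel K)
isTriangleOfSkel? K? T = (∣ T ∣ ℕ.≟ 3) ×-dec allSubset? (λ E → (E ⊆? T) →-dec ((∣ E ∣ ℕ.≟ 2) →-dec K? E))

lemma3p11 : ∀ (n : ℕ) (C : Cx n) → IsComplex C → PureSize 3 C → KDecomposable 1 C →
    Σ (List (Subset n)) λ Fs →
      Unique Fs
      × All (λ F → IsTriangleOfSkel C F × ¬ C F) Fs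
      × (∀ F → IsTriangleOfSkel C F → ¬ C F → F ∈ Fs)
      × (∀ i → 1 ≤ i → i ≤ length Fs → KDecomposable 1 (C +⟨ take i Fs ⟩))
lemma3p11 n C cC pC (s , d) =
  missing , Unique.filter⁺ missing? (allSubsets-unique n) , all-missing , missing-complete , prefix-decomposable
  where
  missing? : Decidable (λ T → IsTriangleOfSkel C T × ¬ C T)
  missing? T = isTriangleOfSkel? (Decomp⇒Decidable d) T ×-dec ¬? (Decomp⇒Decidable d T)
  missing : List (Subset n)
  missing = filter missing? (allSubsets n)
  all-missing : All (λ T → IsTriangleOfSkel C T × ¬ C T) missing
  all-missing = Allₚ.all-filter missing? (allSubsets n)
  missing-complete : ∀ T → IsTriangleOfSkel C T → ¬ C T → T ∈ missing
  missing-complete T T-tri ¬CT = ∈-filter⁺ missing? (∈-allSubsets T) (T-tri , ¬CT)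
  d₃ : Decomp 1 3 C
  d₃ = subst (λ s → Decomp 1 s C) (Decomp-pureSize-≡ d pC) d
  prefix-decomposable : ∀ i → 1 ≤ i → i ≤ length missing → KDecomposable 1 (C +⟨ take i missing ⟩)
  prefix-decomposable i _ _ = 3 , Decomp-+⟨⟩ cC d₃ (s≤s (s≤s z≤n)) ℕ.≤-refl (take i missing)
    (Allₚ.take⁺ i (All.map (λ (T-tri , _) → proj₁ T-tri , triangle⇒BoundaryIn cC T-tri) all-missing))
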